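{- Let $M=(E,\mathcal{B})$ be a binary matroid given by its set of bases. Then there is a finite sequence of handle slides that sends $M$ to a binary matroid whose set of bases consists of a single set.
   Context: Handle slides: for a set system $D=(E,\mathcal{F})$ and $a,b\in E$ with $a\neq b$, $D_{ab}=(E,\mathcal{F}_{ab})$ where $\mathcal{F}_{ab}=\mathcal{F}\,\Delta\,\{X\cup\{a\} : X\subseteq E\setminus\{a,b\},\ X\cup\{b\}\in\mathcal{F}\}$ ($\Delta$ = symmetric difference); the move $D\mapsto D_{ab}$ is the handle slide of $a$ over $b$. A matroid is viewed as the set system $(E,\mathcal{B})$ of its bases. A matroid is binary if representable over $GF(2)$. -}

module Defs where

open import Data.Nat using (ℕ)
open import Data.Bool using (Bool; true; false; _∧_; _xor_)
open import Data.Fin using (Fin)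
open import Data.Fin.Subset using (Subset; _∈_; _∉_; _⊆_; Nonempty; inside; outside)
open import Data.Vec using (Vec; foldr; tabulate; lookup; _[_]≔_)
open import Data.List using (List; []; _∷_)
open import Data.Product using (Σ; _×_; _,_; ∃)
open import Data.Sum using (_⊎_)
open import Relation.Nullary using (¬_)
open import Relation.Binary.PropositionalEquality using (_≡_)
open import Function.Bundles using (_⇔_)

Family : ℕ → Set₁
Family n = Subset n → Set

_Δ_ : ∀ {n} → Family n → Family n → Family n
(F Δ G) S = (F S × ¬ G S) ⊎ (G S × ¬ F S)

-- The family { X ∪ {a} : X ⊆ E \ {a,b}, X ∪ {b} ∈ 𝓕 }.
-- A set S has this form iff a ∈ S, b ∉ S, and (S \ {a}) ∪ {b} ∈ 𝓕 (then X = S \ {a}).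
slideSets : ∀ {n} → Fin n → Fin n → Family n → Family n
slideSets a b F S = (a ∈ S) × (b ∉ S) × F ((S [ a ]≔ outside) [ b ]≔ inside)

handleSlide : ∀ {n} → Fin n → Fin n → Family n → Family n
handleSlide a b F = F Δ slideSets a b F

slides : ∀ {n} → List (Fin n × Fin n) → Family n → Family n
slides []              F = F
slides ((a , b) ∷ ps)  F = slides ps (handleSlide a b F)

-- Linear algebra over GF(2) = Bool with xor as addition, ∧ as multiplication.
-- A is an r × n matrix over GF(2); columns indexed by Fin n.
Matrix : ℕ → ℕ → Set
Matrix r n = Fin r → Fin n → Bool

colSum : ∀ {r n} → Matrix r n → Subset n → Fin r → Bool
colSum {n = n} A T i = foldr (λ _ → Bool) _xor_ false (tabulate (λ j → A i j ∧ lookup T j))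

Dependent : ∀ {r n} → Matrix r n → Subset n → Set
Dependent A S = ∃ λ T → T ⊆ S × Nonempty T × (∀ i → colSum A T i ≡ false)

Independent : ∀ {r n} → Matrix r n → Subset n → Set
Independent A S = ¬ Dependent A S

IsBasis : ∀ {r n} → Matrix r n → Subset n → Set
IsBasis A S = Independent A S × (∀ e → e ∉ S → Dependent A (S [ e ]≔ inside))

Binary : ∀ {n} → Family n → Set
Binary {n} F = Σ ℕ λ r → Σ (Matrix r n) λ A → ∀ S → F S ⇔ IsBasis A S

-- For a ≠ b, sliding a over b in the basis family of the vector matroid M[A] gives the basis
-- family of the matrix A′ obtained from A by adding column b to column a.  If a ∉ S or b ∈ S,
-- combinations of columns of S in A′ and in A are the same vectors (only the coefficient of b
-- changes), so S is a basis of both or of neither.  If a ∈ S and b ∉ S, write S = X ∪ {a}; then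
-- X ∪ {z} is a basis iff X is independent, span X is a hyperplane of the common column space C
-- and z ∉ span X.  As C / span X ≅ GF(2), the column a + b of A′ lies outside span X iff exactly
-- one of a, b does: S is a basis of A′ iff exactly one of X ∪ {a}, X ∪ {b} is a basis of A, which
-- is the symmetric difference defining the handle slide.
-- Finally fix a basis B of M[A] and slide every e ∉ B over the elements of B whose columns sum
-- to column e; this clears all columns outside B, after which B is the only basis.
module Submission where

open import Defs
open import Data.Bool using (Bool; true; false; _xor_; _∧_; not) renaming (_≟_ to _≟ᵇ_)
open import Data.Bool.Properties
  using (xor-∧-commutativeRing; xor-assoc; xor-comm; xor-identityʳ; xor-same;
         ∧-identityʳ; ∧-zeroʳ; ∧-distribˡ-xor; ∧-distribʳ-xor)
open import Data.Fin using (Fin; zero; suc; _≟_)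
open import Data.Fin.Properties using (suc-injective; all?)
open import Data.Fin.Subset using (Subset; _∈_; _∉_; _⊆_; ∁; Nonempty; inside; outside) renaming (⊥ to ∅)
open import Data.Fin.Subset.Properties using (⊆-min; ⊆-antisym; ∉⊥; anySubset?; _⊆?_; nonempty?)
open import Data.List using (List; []; _∷_; _++_; map; concatMap; allFin)
open import Data.List.Membership.Propositional using () renaming (_∈_ to _∈ₗ_)
open import Data.List.Membership.Propositional.Properties using (∈-allFin)
open import Data.List.Relation.Unary.All as All using (All; []; _∷_)
import Data.List.Relation.Unary.All.Properties as Allₚ
open import Data.List.Relation.Unary.Any using (here; there)
open import Data.Maybe using (Maybe; just; nothing)
open import Data.Nat using (ℕ; zero; suc)
open import Data.Product using (Σ; ∃; _×_; _,_; proj₁; proj₂; uncurry)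
open import Data.Product.Function.NonDependent.Propositional using (_×-⇔_)
open import Data.Sum using (_⊎_; inj₁; inj₂; [_,_]′)
open import Data.Sum.Function.Propositional using (_⊎-⇔_)
open import Data.Vec using ([]; lookup; _[_]≔_; tabulate; foldr; zipWith) renaming (_∷_ to _∷ᵥ_)
open import Data.Vec.Properties
  using (lookup-map; lookup-replicate; lookup-zipWith; lookup∘update; lookup∘update′;
         []≔-idempotent; []≔-lookup; []≔-updates; []=⇒lookup; lookup⇒[]=)
open import Function using (_∘_; id; flip)
open import Function.Bundles using (_⇔_; mk⇔; Equivalence)
open import Function.Properties.Equivalence using (⇔-setoid) renaming (refl to ⇔-refl; trans to ⇔-trans)
open import Function.Related.TypeIsomorphisms using (¬-cong-⇔)
open import Level using (0ℓ)
open import Relation.Binary.PropositionalEquality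
import Relation.Binary.Reasoning.Setoid as SetoidReasoning
open import Relation.Nullary using (¬_; Dec; does; yes; no; contradiction)
open import Relation.Nullary.Decidable using (dec-true; dec-false; _×-dec_)
open import Tactic.RingSolver using (solve-∀)
open import Tactic.RingSolver.Core.AlmostCommutativeRing using (AlmostCommutativeRing; fromCommutativeRing)

-- The solver computes coefficients in Bool itself, so it knows x xor x ≡ false.
GF₂ : AlmostCommutativeRing 0ℓ 0ℓ
GF₂ = fromCommutativeRing xor-∧-commutativeRing isFalse
  where
  isFalse : (x : Bool) → Maybe (false ≡ x)
  isFalse false = just refl
  isFalse true  = nothing

xor-cancelˡ : ∀ x y → x xor (x xor y) ≡ y
xor-cancelˡ = solve-∀ GF₂

xor-cancelʳ : ∀ x y → (x xor y) xor y ≡ x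
xor-cancelʳ = solve-∀ GF₂

Vector : ℕ → Set
Vector r = Fin r → Bool

0ᵥ : ∀ {r} → Vector r
0ᵥ _ = false

infixl 6 _+ᵥ_

_+ᵥ_ : ∀ {r} → Vector r → Vector r → Vector r
(u +ᵥ v) i = u i xor v i

col : ∀ {r n} → Matrix r n → Fin n → Vector r
col A e i = A i e

δ : ∀ {n} → Fin n → Fin n → Bool
δ i j = does (i ≟ j)

δ-refl : ∀ {n} (i : Fin n) → δ i i ≡ true
δ-refl i = dec-true (i ≟ i) refl

δ-≢ : ∀ {n} {i j : Fin n} → i ≢ j → δ i j ≡ false
δ-≢ {i = i} {j} = dec-false (i ≟ j)

-- colSum A T i unfolds to ∑ (λ j → A i j ∧ lookup T j).
∑ : ∀ {n} → (Fin n → Bool) → Bool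
∑ f = foldr (λ _ → Bool) _xor_ false (tabulate f)

∑-cong : ∀ {n} {f g : Fin n → Bool} → f ≗ g → ∑ f ≡ ∑ g
∑-cong {zero}  f≗g = refl
∑-cong {suc n} f≗g = cong₂ _xor_ (f≗g zero) (∑-cong (f≗g ∘ suc))

∑-zero : ∀ n → ∑ {n} (λ _ → false) ≡ false
∑-zero zero    = refl
∑-zero (suc n) = ∑-zero n

∑-xor : ∀ {n} (f g : Fin n → Bool) → ∑ (λ j → f j xor g j) ≡ ∑ f xor ∑ g
∑-xor {zero}  f g = refl
∑-xor {suc n} f g = trans (cong ((f zero xor g zero) xor_) (∑-xor (f ∘ suc) (g ∘ suc)))
                          (interchange (f zero) (g zero) (∑ (f ∘ suc)) (∑ (g ∘ suc)))
  where
  interchange : ∀ x y z w → (x xor y) xor (z xor w) ≡ (x xor z) xor (y xor w)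
  interchange = solve-∀ GF₂

∑-δ : ∀ {n} (e : Fin n) (f : Fin n → Bool) → (∀ j → j ≢ e → f j ≡ false) → ∑ f ≡ f e
∑-δ {suc n} zero    f off =
  trans (cong (f zero xor_) (trans (∑-cong (λ j → off (suc j) λ ())) (∑-zero n))) (xor-identityʳ (f zero))
∑-δ {suc n} (suc e) f off =
  trans (cong (_xor ∑ (f ∘ suc)) (off zero λ ())) (∑-δ e (f ∘ suc) (λ j j≢e → off (suc j) (j≢e ∘ suc-injective)))

colSum-update : ∀ {r n} (A : Matrix r n) T e x i →
  colSum A (T [ e ]≔ x) i ≡ colSum A T i xor (A i e ∧ (lookup T e xor x))
colSum-update A T e x i = begin
  ∑ (λ j → A i j ∧ lookup T′ j)
    ≡⟨ ∑-cong (λ j → split (A i j) (lookup T j) (lookup T′ j)) ⟩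
  ∑ (λ j → (A i j ∧ lookup T j) xor change j)
    ≡⟨ ∑-xor _ change ⟩
  colSum A T i xor ∑ change
    ≡⟨ cong (colSum A T i xor_) (∑-δ e change unchanged) ⟩
  colSum A T i xor change e
    ≡⟨ cong (λ y → colSum A T i xor (A i e ∧ (lookup T e xor y))) (lookup∘update e T x) ⟩
  colSum A T i xor (A i e ∧ (lookup T e xor x)) ∎
  where
  open ≡-Reasoning
  T′ = T [ e ]≔ x
  change : Fin _ → Bool
  change j = A i j ∧ (lookup T j xor lookup T′ j)
  split : ∀ a t t′ → a ∧ t′ ≡ (a ∧ t) xor (a ∧ (t xor t′))
  split = solve-∀ GF₂
  unchanged : ∀ j → j ≢ e → change j ≡ false
  unchanged j j≢e = trans (cong (λ y → A i j ∧ (lookup T j xor y)) (lookup∘update′ j≢e T x))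
                          (trans (cong (A i j ∧_) (xor-same (lookup T j))) (∧-zeroʳ (A i j)))

colSum-toggle : ∀ {r n} (A : Matrix r n) T e x → lookup T e ≡ not x →
  colSum A (T [ e ]≔ x) ≗ colSum A T +ᵥ col A e
colSum-toggle A T e x Te≡¬x i = begin
  colSum A (T [ e ]≔ x) i
    ≡⟨ colSum-update A T e x i ⟩
  colSum A T i xor (A i e ∧ (lookup T e xor x))
    ≡⟨ cong (λ y → colSum A T i xor (A i e ∧ (y xor x))) Te≡¬x ⟩
  colSum A T i xor (A i e ∧ (not x xor x))
    ≡⟨ cong (colSum A T i xor_) (toggled (A i e) x) ⟩
  colSum A T i xor A i e ∎
  where
  open ≡-Reasoning
  toggled : ∀ a x → a ∧ (not x xor x) ≡ a
  toggled a true  = ∧-identityʳ a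
  toggled a false = ∧-identityʳ a

colSum-∅ : ∀ {r n} (A : Matrix r n) → colSum A ∅ ≗ 0ᵥ
colSum-∅ {n = n} A i =
  trans (∑-cong (λ j → trans (cong (A i j ∧_) (lookup-replicate j false)) (∧-zeroʳ (A i j)))) (∑-zero n)

colSum-xor : ∀ {r n} (A : Matrix r n) T U → colSum A (zipWith _xor_ T U) ≗ colSum A T +ᵥ colSum A U
colSum-xor A T U i =
  trans (∑-cong λ j → trans (cong (A i j ∧_) (lookup-zipWith _xor_ j T U)) (∧-distribˡ-xor (A i j) (lookup T j) (lookup U j)))
        (∑-xor (λ j → A i j ∧ lookup T j) (λ j → A i j ∧ lookup U j))

colSum-cong : ∀ {r n} {A A′ : Matrix r n} T → (∀ {j} → j ∈ T → col A j ≗ col A′ j) → colSum A T ≗ colSum A′ T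
colSum-cong {A = A} {A′} T agree i = ∑-cong term
  where
  term : ∀ j → A i j ∧ lookup T j ≡ A′ i j ∧ lookup T j
  term j with lookup T j in Tj
  ... | true  = cong (_∧ true) (agree (lookup⇒[]= j T Tj) i)
  ... | false = trans (∧-zeroʳ (A i j)) (sym (∧-zeroʳ (A′ i j)))

module _ {n : ℕ} where

  ⊆-by-lookup : {T X : Subset n} → (∀ j → lookup T j ≡ true → lookup X j ≡ true) → T ⊆ X
  ⊆-by-lookup f {j} j∈T = lookup⇒[]= j _ (f j ([]=⇒lookup j∈T))

  ⊆-lookup : {T X : Subset n} → T ⊆ X → ∀ {j} → lookup T j ≡ true → lookup X j ≡ true
  ⊆-lookup {T} T⊆X {j} Tj = []=⇒lookup (T⊆X (lookup⇒[]= j T Tj))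

  ⊆-lookup-false : {T X : Subset n} → T ⊆ X → ∀ {j} → lookup X j ≡ false → lookup T j ≡ false
  ⊆-lookup-false {T} T⊆X {j} Xj with lookup T j in Tj
  ... | false = refl
  ... | true  = trans (sym (⊆-lookup T⊆X Tj)) Xj

  lookup-false⇒∉ : {S : Subset n} {e : Fin n} → lookup S e ≡ false → e ∉ S
  lookup-false⇒∉ Se e∈S = contradiction (trans (sym ([]=⇒lookup e∈S)) Se) λ ()

  ⊆-update : {T Y : Subset n} (e : Fin n) (x : Bool) → T ⊆ Y → T [ e ]≔ x ⊆ Y [ e ]≔ x
  ⊆-update {T} {Y} e x T⊆Y = ⊆-by-lookup at
    where
    at : ∀ j → lookup (T [ e ]≔ x) j ≡ true → lookup (Y [ e ]≔ x) j ≡ true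
    at j T′j with j ≟ e
    ... | yes refl = trans (lookup∘update e Y x) (trans (sym (lookup∘update e T x)) T′j)
    ... | no j≢e   = trans (lookup∘update′ j≢e Y x) (⊆-lookup T⊆Y (trans (sym (lookup∘update′ j≢e T x)) T′j))

  ⊆-insert : {X : Subset n} (e : Fin n) → X ⊆ X [ e ]≔ inside
  ⊆-insert {X} e = ⊆-by-lookup at
    where
    at : ∀ j → lookup X j ≡ true → lookup (X [ e ]≔ true) j ≡ true
    at j Xj with j ≟ e
    ... | yes refl = lookup∘update e X true
    ... | no j≢e   = trans (lookup∘update′ j≢e X true) Xj

  ⊆-remove : {U Y : Subset n} (e : Fin n) {x : Bool} → U ⊆ Y [ e ]≔ x → U [ e ]≔ outside ⊆ Y
  ⊆-remove {U} {Y} e {x} U⊆Y′ = ⊆-by-lookup at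
    where
    at : ∀ j → lookup (U [ e ]≔ false) j ≡ true → lookup Y j ≡ true
    at j U′j with j ≟ e
    ... | yes refl = contradiction (trans (sym (lookup∘update e U false)) U′j) λ ()
    ... | no j≢e   = trans (sym (lookup∘update′ j≢e Y x)) (⊆-lookup U⊆Y′ (trans (sym (lookup∘update′ j≢e U false)) U′j))

  ⊆-update⁻ : {U Y : Subset n} (e : Fin n) {x : Bool} → U ⊆ Y [ e ]≔ x → lookup U e ≡ false → U ⊆ Y
  ⊆-update⁻ {U} e U⊆Y′ Ue = subst (_⊆ _) (trans (cong (U [ e ]≔_) (sym Ue)) ([]≔-lookup U e)) (⊆-remove e U⊆Y′)

  insert-⊆ : {T Y : Subset n} (e : Fin n) → T ⊆ Y → lookup Y e ≡ true → T [ e ]≔ inside ⊆ Y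
  insert-⊆ {T} {Y} e T⊆Y Ye = ⊆-by-lookup at
    where
    at : ∀ j → lookup (T [ e ]≔ true) j ≡ true → lookup Y j ≡ true
    at j T′j with j ≟ e
    ... | yes refl = Ye
    ... | no j≢e   = ⊆-lookup T⊆Y (trans (sym (lookup∘update′ j≢e T true)) T′j)

  xor-⊆ : {T U X : Subset n} → T ⊆ X → U ⊆ X → zipWith _xor_ T U ⊆ X
  xor-⊆ {T} {U} {X} T⊆X U⊆X = ⊆-by-lookup at
    where
    at : ∀ j → lookup (zipWith _xor_ T U) j ≡ true → lookup X j ≡ true
    at j TUj with lookup T j in Tj | lookup U j in Uj
    ... | true  | _     = ⊆-lookup T⊆X Tj
    ... | false | true  = ⊆-lookup U⊆X Uj
    ... | false | false = contradiction (trans (sym TUj) (trans (lookup-zipWith _xor_ j T U) (cong₂ _xor_ Tj Uj))) λ ()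

Span : ∀ {r n} → Matrix r n → Subset n → Vector r → Set
Span {n = n} A X v = Σ (Subset n) λ T → T ⊆ X × colSum A T ≗ v

Spanning : ∀ {r n} → Matrix r n → Subset n → Set
Spanning A S = ∀ e → Span A S (col A e)

module _ {r n} {A : Matrix r n} {X : Subset n} where

  span-resp : ∀ {u v} → u ≗ v → Span A X u → Span A X v
  span-resp u≗v (T , T⊆X , sum) = T , T⊆X , λ i → trans (sum i) (u≗v i)

  span-0 : Span A X 0ᵥ
  span-0 = ∅ , ⊆-min X , colSum-∅ A

  span-+ : ∀ {u v} → Span A X u → Span A X v → Span A X (u +ᵥ v)
  span-+ (T , T⊆X , sumT) (U , U⊆X , sumU) =
    zipWith _xor_ T U , xor-⊆ T⊆X U⊆X , λ i → trans (colSum-xor A T U i) (cong₂ _xor_ (sumT i) (sumU i))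

  span-col : ∀ {e} → lookup X e ≡ true → Span A X (col A e)
  span-col {e} Xe =
    ∅ [ e ]≔ inside , insert-⊆ e (⊆-min X) Xe ,
    λ i → trans (colSum-toggle A ∅ e true (lookup-replicate e false) i) (cong (_xor A i e) (colSum-∅ A i))

span-mono : ∀ {r n} {A : Matrix r n} {X Y : Subset n} {v} → X ⊆ Y → Span A X v → Span A Y v
span-mono X⊆Y (T , T⊆X , sum) = T , X⊆Y ∘ T⊆X , sum

dependent-mono : ∀ {r n} {A : Matrix r n} {X Y : Subset n} → X ⊆ Y → Dependent A X → Dependent A Y
dependent-mono X⊆Y (T , T⊆X , nonempty , sum) = T , X⊆Y ∘ T⊆X , nonempty , sum

SpanWith : ∀ {r n} → Matrix r n → Subset n → Vector r → Vector r → Set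
SpanWith A X z v = Span A X v ⊎ Span A X (v +ᵥ z)

module _ {r n} {A : Matrix r n} {X : Subset n} {z : Vector r} where

  spanWith-resp : ∀ {u v} → u ≗ v → SpanWith A X z u → SpanWith A X z v
  spanWith-resp u≗v (inj₁ s) = inj₁ (span-resp u≗v s)
  spanWith-resp u≗v (inj₂ s) = inj₂ (span-resp (λ i → cong (_xor z i) (u≗v i)) s)

  spanWith-+ : ∀ {u v} → SpanWith A X z u → SpanWith A X z v → SpanWith A X z (u +ᵥ v)
  spanWith-+         (inj₁ su) (inj₁ sv) = inj₁ (span-+ su sv)
  spanWith-+ {u} {v} (inj₁ su) (inj₂ sv) = inj₂ (span-resp (λ i → sym (xor-assoc (u i) (v i) (z i))) (span-+ su sv))
  spanWith-+ {u} {v} (inj₂ su) (inj₁ sv) = inj₂ (span-resp (λ i → rearrange (u i) (v i) (z i)) (span-+ su sv))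
    where
    rearrange : ∀ x y c → (x xor c) xor y ≡ (x xor y) xor c
    rearrange = solve-∀ GF₂
  spanWith-+ {u} {v} (inj₂ su) (inj₂ sv) = inj₁ (span-resp (λ i → cancel (u i) (v i) (z i)) (span-+ su sv))
    where
    cancel : ∀ x y c → (x xor c) xor (y xor c) ≡ x xor y
    cancel = solve-∀ GF₂

module _ {r n} {A : Matrix r n} {X : Subset n} {e : Fin n} where

  span-insert⁻ : ∀ {v} → Span A (X [ e ]≔ inside) v → SpanWith A X (col A e) v
  span-insert⁻ (T , T⊆X′ , sum) with lookup T e in Te
  ... | false = inj₁ (T , ⊆-update⁻ e T⊆X′ Te , sum)
  ... | true  = inj₂ (T [ e ]≔ outside , ⊆-remove e T⊆X′ ,
                      λ i → trans (colSum-toggle A T e false Te i) (cong (_xor A i e) (sum i)))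

  span-insert⁺ : ∀ {v} → SpanWith A X (col A e) v → Span A (X [ e ]≔ inside) v
  span-insert⁺     (inj₁ s) = span-mono (⊆-insert e) s
  span-insert⁺ {v} (inj₂ s) = span-resp (λ i → xor-cancelʳ (v i) (A i e))
    (span-+ (span-mono (⊆-insert e) s) (span-col (lookup∘update e X true)))

  dependent-insert⁻ : Dependent A (X [ e ]≔ inside) → Dependent A X ⊎ Span A X (col A e)
  dependent-insert⁻ (T , T⊆X′ , nonempty , sum) with lookup T e in Te
  ... | false = inj₁ (T , ⊆-update⁻ e T⊆X′ Te , nonempty , sum)
  ... | true  = inj₂ (T [ e ]≔ outside , ⊆-remove e T⊆X′ ,
                      λ i → trans (colSum-toggle A T e false Te i) (cong (_xor A i e) (sum i)))

  span⇒dependent-insert : lookup X e ≡ false → Span A X (col A e) → Dependent A (X [ e ]≔ inside)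
  span⇒dependent-insert Xe (T , T⊆X , sum) =
    T [ e ]≔ inside , ⊆-update e true T⊆X , (e , []≔-updates T e) ,
    λ i → trans (colSum-toggle A T e true (⊆-lookup-false T⊆X Xe) i) (trans (cong (_xor A i e) (sum i)) (xor-same (A i e)))

isBasis⇔independent×spanning : ∀ {r n} {A : Matrix r n} {S : Subset n} →
  IsBasis A S ⇔ (Independent A S × Spanning A S)
isBasis⇔independent×spanning {A = A} {S} = mk⇔ to from
  where
  to : IsBasis A S → Independent A S × Spanning A S
  to (independent , maximal) = independent , spanning
    where
    spanning : Spanning A S
    spanning e with lookup S e in Se
    ... | true  = span-col Se
    ... | false = [ flip contradiction independent , id ]′ (dependent-insert⁻ (maximal e (lookup-false⇒∉ Se)))
  from : Independent A S × Spanning A S → IsBasis A S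
  from (independent , spanning) = independent , maximal
    where
    maximal : ∀ e → e ∉ S → Dependent A (S [ e ]≔ inside)
    maximal e e∉S with lookup S e in Se
    ... | true  = contradiction (lookup⇒[]= e S Se) e∉S
    ... | false = span⇒dependent-insert Se (spanning e)

-- span X is a hyperplane of the column space and z lies outside it; for independent X this says
-- that X ∪ {z} is a basis.
Extends : ∀ {r n} → Matrix r n → Subset n → Vector r → Set
Extends A X z = ¬ Span A X z × (∀ e → SpanWith A X z (col A e))

isBasis-insert⇔ : ∀ {r n} {A : Matrix r n} {X : Subset n} {e} → lookup X e ≡ false →
  IsBasis A (X [ e ]≔ inside) ⇔ (Independent A X × Extends A X (col A e))
isBasis-insert⇔ {A = A} {X} {e} Xe = mk⇔ to from
  where
  to : IsBasis A (X [ e ]≔ inside) → Independent A X × Extends A X (col A e)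
  to basis with Equivalence.to isBasis⇔independent×spanning basis
  ... | independent , spanning =
    independent ∘ dependent-mono (⊆-insert e) , independent ∘ span⇒dependent-insert Xe , span-insert⁻ ∘ spanning
  from : Independent A X × Extends A X (col A e) → IsBasis A (X [ e ]≔ inside)
  from (independent , ¬span , extends) = Equivalence.from isBasis⇔independent×spanning
    ([ independent , ¬span ]′ ∘ dependent-insert⁻ , span-insert⁺ ∘ extends)

module _ {r n} {A : Matrix r n} {X : Subset n} where

  extends-shift : ∀ {z z′} → Span A X (z +ᵥ z′) → Extends A X z → Extends A X z′
  extends-shift {z} {z′} s (¬span , extends) = ¬span ∘ back , forth ∘ extends
    where
    back : Span A X z′ → Span A X z
    back s′ = span-resp (λ i → xor-cancelʳ (z i) (z′ i)) (span-+ s s′)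
    shift : ∀ c z z′ → (c xor z) xor (z xor z′) ≡ c xor z′
    shift = solve-∀ GF₂
    forth : ∀ {c} → SpanWith A X z c → SpanWith A X z′ c
    forth     (inj₁ sc) = inj₁ sc
    forth {c} (inj₂ sc) = inj₂ (span-resp (λ i → shift (c i) (z i) (z′ i)) (span-+ sc s))

  extends-resp : ∀ {z z′} → z ≗ z′ → Extends A X z → Extends A X z′
  extends-resp {z} {z′} z≗z′ =
    extends-shift (span-resp (λ i → sym (trans (cong (_xor z′ i) (z≗z′ i)) (xor-same (z′ i)))) span-0)

infixr 1 _⊻_

-- handleSlide a b F S unfolds to F S ⊻ slideSets a b F S.
_⊻_ : Set → Set → Set
P ⊻ Q = (P × ¬ Q) ⊎ (Q × ¬ P)

⊻-cong : ∀ {P P′ Q Q′ : Set} → P ⇔ P′ → Q ⇔ Q′ → (P ⊻ Q) ⇔ (P′ ⊻ Q′)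
⊻-cong P⇔P′ Q⇔Q′ = (P⇔P′ ×-⇔ ¬-cong-⇔ Q⇔Q′) ⊎-⇔ (Q⇔Q′ ×-⇔ ¬-cong-⇔ P⇔P′)

⊻-identityʳ : ∀ {P Q : Set} → ¬ Q → (P ⊻ Q) ⇔ P
⊻-identityʳ ¬q = mk⇔ (λ { (inj₁ (p , _)) → p ; (inj₂ (q , _)) → contradiction q ¬q }) (λ p → inj₁ (p , ¬q))

×-distribˡ-⊻ : ∀ {P Q R : Set} → (P × (Q ⊻ R)) ⇔ ((P × Q) ⊻ (P × R))
×-distribˡ-⊻ = mk⇔
  (λ { (p , inj₁ (q , ¬r)) → inj₁ ((p , q) , ¬r ∘ proj₂)
      ; (p , inj₂ (r , ¬q)) → inj₂ ((p , r) , ¬q ∘ proj₂) })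
  (λ { (inj₁ ((p , q) , ¬pr)) → p , inj₁ (q , λ r → ¬pr (p , r))
      ; (inj₂ ((p , r) , ¬pq)) → p , inj₂ (r , λ q → ¬pq (p , q)) })

-- When Extends A X z holds, the column space modulo span X is GF(2) with z as its nonzero element.
extends-⊻ : ∀ {r n} {A : Matrix r n} {X : Subset n} a b →
  Extends A X (col A a +ᵥ col A b) ⇔ (Extends A X (col A a) ⊻ Extends A X (col A b))
extends-⊻ {r} {A = A} {X} a b = mk⇔ to from
  where
  u w : Vector r
  u = col A a
  w = col A b
  swap : ∀ {x y} → Span A X (x +ᵥ y) → Span A X (y +ᵥ x)
  swap {x} {y} = span-resp (λ i → xor-comm (x i) (y i))
  cancel : ∀ x y → (x xor y) xor x ≡ y
  cancel = solve-∀ GF₂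
  cancel′ : ∀ x y → y xor (x xor y) ≡ x
  cancel′ = solve-∀ GF₂
  to : Extends A X (u +ᵥ w) → Extends A X u ⊻ Extends A X w
  to E with proj₂ E a
  ... | inj₁ su  = inj₂ (extends-shift (span-resp (λ i → sym (xor-cancelʳ (u i) (w i))) su) E , λ Eu → proj₁ Eu su)
  ... | inj₂ suw = inj₁ (extends-shift (span-resp (λ i → sym (cancel (u i) (w i))) sw) E , λ Ew → proj₁ Ew sw)
    where
    sw : Span A X w
    sw = span-resp (λ i → xor-cancelˡ (u i) (w i)) suw
  from : Extends A X u ⊻ Extends A X w → Extends A X (u +ᵥ w)
  from (inj₁ (Eu , ¬Ew)) with proj₂ Eu b
  ... | inj₁ sw  = extends-shift (span-resp (λ i → sym (xor-cancelˡ (u i) (w i))) sw) Eu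
  ... | inj₂ swu = contradiction (extends-shift (swap {w} {u} swu) Eu) ¬Ew
  from (inj₂ (Ew , ¬Eu)) with proj₂ Ew a
  ... | inj₁ su  = extends-shift (span-resp (λ i → sym (cancel′ (u i) (w i))) su) Ew
  ... | inj₂ suw = contradiction (extends-shift (swap {u} {w} suw) Ew) ¬Eu

addColumn : ∀ {r n} → Fin n → Fin n → Matrix r n → Matrix r n
addColumn a b A i j = A i j xor (δ j a ∧ A i b)

record ColumnAdded {r n} (a b : Fin n) (A A′ : Matrix r n) : Set where
  field entries : ∀ i j → A′ i j ≡ A i j xor (δ j a ∧ A i b)

Closed : ∀ {n} → Fin n → Fin n → Subset n → Set
Closed a b S = lookup S a ≡ true → lookup S b ≡ true

module _ {r n} {a b : Fin n} (a≢b : a ≢ b) {A A′ : Matrix r n} (added : ColumnAdded a b A A′) where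

  open ColumnAdded added

  col-≢ : ∀ {j} → j ≢ a → col A′ j ≗ col A j
  col-≢ {j} j≢a i = trans (entries i j) (trans (cong (λ d → A i j xor (d ∧ A i b)) (δ-≢ j≢a)) (xor-identityʳ (A i j)))

  col-a : col A′ a ≗ col A a +ᵥ col A b
  col-a i = trans (entries i a) (cong (λ d → A i a xor (d ∧ A i b)) (δ-refl a))

  columnAdded-sym : ColumnAdded a b A′ A
  columnAdded-sym = record { entries = λ i j → begin
    A i j
      ≡⟨ xor-cancelʳ (A i j) (δ j a ∧ A i b) ⟨
    (A i j xor (δ j a ∧ A i b)) xor (δ j a ∧ A i b)
      ≡⟨ cong₂ (λ x y → x xor (δ j a ∧ y)) (entries i j) (col-≢ (a≢b ∘ sym) i) ⟨
    A′ i j xor (δ j a ∧ A′ i b) ∎ }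
    where open ≡-Reasoning

  -- A combination of the columns of A′ is the combination of the columns of A in which the
  -- coefficient of b is increased by that of a.
  shift : Subset n → Subset n
  shift T = T [ b ]≔ (lookup T b xor lookup T a)

  colSum-shift : ∀ T → colSum A′ T ≗ colSum A (shift T)
  colSum-shift T i = begin
    ∑ (λ j → A′ i j ∧ lookup T j)
      ≡⟨ ∑-cong (λ j → trans (cong (_∧ lookup T j) (entries i j)) (∧-distribʳ-xor _ (A i j) _)) ⟩
    ∑ (λ j → (A i j ∧ lookup T j) xor extra j)
      ≡⟨ ∑-xor _ extra ⟩
    colSum A T i xor ∑ extra
      ≡⟨ cong (colSum A T i xor_) (∑-δ a extra λ j j≢a → cong (λ d → (d ∧ A i b) ∧ lookup T j) (δ-≢ j≢a)) ⟩
    colSum A T i xor extra a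
      ≡⟨ cong (λ d → colSum A T i xor ((d ∧ A i b) ∧ lookup T a)) (δ-refl a) ⟩
    colSum A T i xor (A i b ∧ lookup T a)
      ≡⟨ cong (λ y → colSum A T i xor (A i b ∧ y)) (xor-cancelˡ (lookup T b) (lookup T a)) ⟨
    colSum A T i xor (A i b ∧ (lookup T b xor (lookup T b xor lookup T a)))
      ≡⟨ colSum-update A T b _ i ⟨
    colSum A (shift T) i ∎
    where
    open ≡-Reasoning
    extra : Fin n → Bool
    extra j = (δ j a ∧ A i b) ∧ lookup T j

  shift-⊆ : ∀ {S T} → Closed a b S → T ⊆ S → shift T ⊆ S
  shift-⊆ {S} {T} closed T⊆S = ⊆-by-lookup at
    where
    at : ∀ j → lookup (shift T) j ≡ true → lookup S j ≡ true
    at j Tj with j ≟ b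
    ... | no j≢b   = ⊆-lookup T⊆S (trans (sym (lookup∘update′ j≢b T _)) Tj)
    ... | yes refl with lookup T b in Tb | lookup T a in Ta
    ...   | true  | _     = ⊆-lookup T⊆S Tb
    ...   | false | true  = closed (⊆-lookup T⊆S Ta)
    ...   | false | false = contradiction (trans (sym Tj) (lookup∘update b T _)) λ ()

  shift-id : ∀ {T} → lookup T a ≡ false → shift T ≡ T
  shift-id {T} Ta = trans (cong (λ y → T [ b ]≔ (lookup T b xor y)) Ta)
                          (trans (cong (T [ b ]≔_) (xor-identityʳ (lookup T b))) ([]≔-lookup T b))

  shift-nonempty : ∀ {T} → Nonempty T → Nonempty (shift T)
  shift-nonempty {T} (j , j∈T) = by-cases (lookup T a) refl
    where
    by-cases : ∀ x → lookup T a ≡ x → Nonempty (shift T)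
    by-cases true  Ta = a , lookup⇒[]= a _ (trans (lookup∘update′ a≢b T _) Ta)
    by-cases false Ta = j , subst (j ∈_) (sym (shift-id Ta)) j∈T

  span-transfer : ∀ {S v} → Closed a b S → Span A′ S v → Span A S v
  span-transfer closed (T , T⊆S , sum) = shift T , shift-⊆ closed T⊆S , λ i → trans (sym (colSum-shift T i)) (sum i)

  dependent-transfer : ∀ {S} → Closed a b S → Dependent A′ S → Dependent A S
  dependent-transfer closed (T , T⊆S , nonempty , sum) =
    shift T , shift-⊆ closed T⊆S , shift-nonempty nonempty , λ i → trans (sym (colSum-shift T i)) (sum i)

  columns-transfer : (P : Vector r → Set) → (∀ {u v} → u ≗ v → P u → P v) → (∀ {u v} → P u → P v → P (u +ᵥ v)) →
    (∀ e → P (col A e)) → ∀ e → P (col A′ e)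
  columns-transfer P resp closed-+ columns e with e ≟ a
  ... | yes refl = resp (λ i → sym (col-a i)) (closed-+ (columns a) (columns b))
  ... | no e≢a   = resp (λ i → sym (col-≢ e≢a i)) (columns e)

module _ {r n} {a b : Fin n} (a≢b : a ≢ b) {A A′ : Matrix r n} (added : ColumnAdded a b A A′) where

  private
    added′ = columnAdded-sym a≢b added

  isBasis-transfer : ∀ {S} → Closed a b S → IsBasis A S → IsBasis A′ S
  isBasis-transfer {S} closed basis with Equivalence.to isBasis⇔independent×spanning basis
  ... | independent , spanning = Equivalence.from isBasis⇔independent×spanning
    ( independent ∘ dependent-transfer a≢b added closed
    , span-transfer a≢b added′ closed ∘ columns-transfer a≢b added (Span A S) span-resp span-+ spanning )

  extends-transfer : ∀ {X z} → Closed a b X → Extends A X z → Extends A′ X z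
  extends-transfer {X} {z} closed (¬span , extends) =
    ¬span ∘ span-transfer a≢b added closed ,
    spanWith-transfer ∘ columns-transfer a≢b added (SpanWith A X z) spanWith-resp spanWith-+ extends
    where
    spanWith-transfer : ∀ {v} → SpanWith A X z v → SpanWith A′ X z v
    spanWith-transfer (inj₁ s) = inj₁ (span-transfer a≢b added′ closed s)
    spanWith-transfer (inj₂ s) = inj₂ (span-transfer a≢b added′ closed s)

slideSets-closed : ∀ {n} {a b : Fin n} {F : Family n} {S} → Closed a b S → ¬ slideSets a b F S
slideSets-closed closed (a∈S , b∉S , _) = b∉S (lookup⇒[]= _ _ (closed ([]=⇒lookup a∈S)))

closed⊎crossing : ∀ {n} (a b : Fin n) S → Closed a b S ⊎ (lookup S a ≡ true × lookup S b ≡ false)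
closed⊎crossing a b S with lookup S a | lookup S b
... | false | _     = inj₁ λ ()
... | true  | true  = inj₁ λ _ → refl
... | true  | false = inj₂ (refl , refl)

handleSlide-isBasis : ∀ {r n} {a b : Fin n} (A : Matrix r n) → a ≢ b →
  ∀ S → handleSlide a b (IsBasis A) S ⇔ IsBasis (addColumn a b A) S
handleSlide-isBasis {a = a} {b} A a≢b S = [ closed-case , uncurry crossing-case ]′ (closed⊎crossing a b S)
  where
  A′ = addColumn a b A
  added : ColumnAdded a b A A′
  added = record { entries = λ i j → refl }
  added′ : ColumnAdded a b A′ A
  added′ = columnAdded-sym a≢b added

  closed-case : Closed a b S → handleSlide a b (IsBasis A) S ⇔ IsBasis A′ S
  closed-case closed = ⇔-trans (⊻-identityʳ (slideSets-closed {F = IsBasis A} closed))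
                               (mk⇔ (isBasis-transfer a≢b added closed) (isBasis-transfer a≢b added′ closed))

  crossing-case : lookup S a ≡ true → lookup S b ≡ false → handleSlide a b (IsBasis A) S ⇔ IsBasis A′ S
  crossing-case Sa Sb = begin
    (IsBasis A S ⊻ slideSets a b (IsBasis A) S)
      ≈⟨ ⊻-cong (basis-S A) (⇔-trans slide (isBasis-insert⇔ Xb)) ⟩
    ((Independent A X × Extends A X (col A a)) ⊻ (Independent A X × Extends A X (col A b)))
      ≈⟨ ×-distribˡ-⊻ ⟨
    (Independent A X × (Extends A X (col A a) ⊻ Extends A X (col A b)))
      ≈⟨ ⇔-refl ×-⇔ extends-⊻ a b ⟨
    (Independent A X × Extends A X (col A a +ᵥ col A b))
      ≈⟨ independent-transfer ×-⇔ extends-col-a ⟩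
    (Independent A′ X × Extends A′ X (col A′ a))
      ≈⟨ basis-S A′ ⟨
    IsBasis A′ S ∎
    where
    open SetoidReasoning (⇔-setoid 0ℓ)
    X = S [ a ]≔ outside
    Xa : lookup X a ≡ false
    Xa = lookup∘update a S false
    Xb : lookup X b ≡ false
    Xb = trans (lookup∘update′ (a≢b ∘ sym) S false) Sb
    X-closed : Closed a b X
    X-closed Xa≡true = contradiction (trans (sym Xa) Xa≡true) λ ()
    X∪a≡S : X [ a ]≔ inside ≡ S
    X∪a≡S = trans ([]≔-idempotent S a) (trans (cong (S [ a ]≔_) (sym Sa)) ([]≔-lookup S a))
    basis-S : ∀ B → IsBasis B S ⇔ (Independent B X × Extends B X (col B a))
    basis-S B = subst (λ T → IsBasis B T ⇔ (Independent B X × Extends B X (col B a))) X∪a≡S (isBasis-insert⇔ Xa)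
    slide : slideSets a b (IsBasis A) S ⇔ IsBasis A (X [ b ]≔ inside)
    slide = mk⇔ (proj₂ ∘ proj₂) (λ basis → lookup⇒[]= a S Sa , lookup-false⇒∉ Sb , basis)
    independent-transfer : Independent A X ⇔ Independent A′ X
    independent-transfer = mk⇔ (λ ind → ind ∘ dependent-transfer a≢b added X-closed)
                               (λ ind → ind ∘ dependent-transfer a≢b added′ X-closed)
    extends-col-a : Extends A X (col A a +ᵥ col A b) ⇔ Extends A′ X (col A′ a)
    extends-col-a = mk⇔ (extends-resp (λ i → sym (col-a a≢b added i)) ∘ extends-transfer a≢b added X-closed)
                        (extends-transfer a≢b added′ X-closed ∘ extends-resp (col-a a≢b added))

handleSlide-cong : ∀ {n} (a b : Fin n) {F G : Family n} → (∀ S → F S ⇔ G S) →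
  ∀ S → handleSlide a b F S ⇔ handleSlide a b G S
handleSlide-cong a b F⇔G S = ⊻-cong (F⇔G S) (⇔-refl ×-⇔ ⇔-refl ×-⇔ F⇔G _)

slides-cong : ∀ {n} (ps : List (Fin n × Fin n)) {F G : Family n} → (∀ S → F S ⇔ G S) →
  ∀ S → slides ps F S ⇔ slides ps G S
slides-cong []             F⇔G = F⇔G
slides-cong ((a , b) ∷ ps) F⇔G = slides-cong ps (handleSlide-cong a b F⇔G)

addColumns : ∀ {r n} → List (Fin n × Fin n) → Matrix r n → Matrix r n
addColumns []             A = A
addColumns ((a , b) ∷ ps) A = addColumns ps (addColumn a b A)

slides-isBasis : ∀ {r n} (ps : List (Fin n × Fin n)) (A : Matrix r n) → All (λ p → proj₁ p ≢ proj₂ p) ps →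
  ∀ S → slides ps (IsBasis A) S ⇔ IsBasis (addColumns ps A) S
slides-isBasis []             A []          S = ⇔-refl
slides-isBasis ((a , b) ∷ ps) A (a≢b ∷ ≢ps) S =
  ⇔-trans (slides-cong ps (handleSlide-isBasis A a≢b) S) (slides-isBasis ps (addColumn a b A) ≢ps S)

dependent? : ∀ {r n} (A : Matrix r n) S → Dec (Dependent A S)
dependent? A S = anySubset? λ T → T ⊆? S ×-dec nonempty? T ×-dec all? λ i → colSum A T i ≟ᵇ false

independent-∅ : ∀ {r n} (A : Matrix r n) → Independent A ∅
independent-∅ A (T , T⊆∅ , (j , j∈T) , _) = ∉⊥ (T⊆∅ j∈T)

extend-independent : ∀ {r n} (A : Matrix r n) (es : List (Fin n)) S → Independent A S →
  Σ (Subset n) λ S′ → S ⊆ S′ × Independent A S′ × (∀ {e} → e ∈ₗ es → e ∉ S′ → Dependent A (S′ [ e ]≔ inside))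
extend-independent A []       S independent = S , id , independent , λ ()
extend-independent A (e ∷ es) S independent with dependent? A (S [ e ]≔ inside)
... | yes dependent
  with S′ , S⊆S′ , independent′ , maximal ← extend-independent A es S independent
  = S′ , S⊆S′ , independent′ ,
    λ { (here refl) _ → dependent-mono (⊆-update e true S⊆S′) dependent ; (there e∈es) → maximal e∈es }
... | no independent+e
  with S′ , S+e⊆S′ , independent′ , maximal ← extend-independent A es (S [ e ]≔ inside) independent+e
  = S′ , S+e⊆S′ ∘ ⊆-insert e , independent′ ,
    λ { (here refl) e∉S′ → contradiction (S+e⊆S′ ([]≔-updates S e)) e∉S′ ; (there e∈es) → maximal e∈es }

basis-exists : ∀ {r n} (A : Matrix r n) → ∃ (IsBasis A)
basis-exists {n = n} A with B , _ , independent , maximal ← extend-independent A (allFin n) ∅ (independent-∅ A)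
  = B , independent , λ e → maximal (∈-allFin e)

∑ₗ : ∀ {X : Set} → (X → Bool) → List X → Bool
∑ₗ g []       = false
∑ₗ g (x ∷ xs) = g x xor ∑ₗ g xs

module _ {X : Set} where

  ∑ₗ-++ : ∀ (g : X → Bool) xs ys → ∑ₗ g (xs ++ ys) ≡ ∑ₗ g xs xor ∑ₗ g ys
  ∑ₗ-++ g []       ys = refl
  ∑ₗ-++ g (x ∷ xs) ys = trans (cong (g x xor_) (∑ₗ-++ g xs ys)) (sym (xor-assoc (g x) _ _))

  ∑ₗ-map : ∀ {Y : Set} (g : Y → Bool) (f : X → Y) xs → ∑ₗ g (map f xs) ≡ ∑ₗ (g ∘ f) xs
  ∑ₗ-map g f []       = refl
  ∑ₗ-map g f (x ∷ xs) = cong (g (f x) xor_) (∑ₗ-map g f xs)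

  ∑ₗ-∧ : ∀ c (g : X → Bool) xs → ∑ₗ (λ x → c ∧ g x) xs ≡ c ∧ ∑ₗ g xs
  ∑ₗ-∧ c g []       = sym (∧-zeroʳ c)
  ∑ₗ-∧ c g (x ∷ xs) = trans (cong ((c ∧ g x) xor_) (∑ₗ-∧ c g xs)) (sym (∧-distribˡ-xor c (g x) _))

  ∑ₗ-cong : ∀ {P : X → Set} {f g : X → Bool} {xs} → All P xs → (∀ {x} → P x → f x ≡ g x) → ∑ₗ f xs ≡ ∑ₗ g xs
  ∑ₗ-cong []         f≡g = refl
  ∑ₗ-cong (px ∷ pxs) f≡g = cong₂ _xor_ (f≡g px) (∑ₗ-cong pxs f≡g)

elements : ∀ {n} → Subset n → List (Fin n)
elements []            = []
elements (true  ∷ᵥ T) = zero ∷ map suc (elements T)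
elements (false ∷ᵥ T) = map suc (elements T)

elements-⊆ : ∀ {n} (T : Subset n) → All (λ j → lookup T j ≡ true) (elements T)
elements-⊆ []            = []
elements-⊆ (true  ∷ᵥ T) = refl ∷ Allₚ.map⁺ (elements-⊆ T)
elements-⊆ (false ∷ᵥ T) = Allₚ.map⁺ (elements-⊆ T)

∑ₗ-elements : ∀ {n} (g : Fin n → Bool) T → ∑ₗ g (elements T) ≡ ∑ (λ j → g j ∧ lookup T j)
∑ₗ-elements g []            = refl
∑ₗ-elements g (true  ∷ᵥ T) =
  cong₂ _xor_ (sym (∧-identityʳ (g zero))) (trans (∑ₗ-map g suc (elements T)) (∑ₗ-elements (g ∘ suc) T))
∑ₗ-elements g (false ∷ᵥ T) =
  trans (∑ₗ-map g suc (elements T))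
        (trans (∑ₗ-elements (g ∘ suc) T) (sym (cong (_xor ∑ (λ j → g (suc j) ∧ lookup T j)) (∧-zeroʳ (g zero)))))

-- Slides of this kind never change a column of B, so their effects simply add up.
AddsFrom : ∀ {n} → Subset n → Fin n × Fin n → Set
AddsFrom B (e , b) = lookup B e ≡ false × lookup B b ≡ true

addsFrom⇒≢ : ∀ {n} (B : Subset n) {p} → AddsFrom B p → proj₁ p ≢ proj₂ p
addsFrom⇒≢ B (Ba , Bb) refl = contradiction (trans (sym Ba) Bb) λ ()

addColumns-sum : ∀ {r n} (B : Subset n) ps (M : Matrix r n) → All (AddsFrom B) ps →
  ∀ i j → addColumns ps M i j ≡ M i j xor ∑ₗ (λ (e , b) → δ j e ∧ M i b) ps
addColumns-sum B []             M []                 i j = sym (xor-identityʳ (M i j))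
addColumns-sum B ((e , b) ∷ ps) M (e,b-adds ∷ adds) i j = begin
  addColumns ps M′ i j
    ≡⟨ addColumns-sum B ps M′ adds i j ⟩
  M′ i j xor ∑ₗ (λ (e′ , b′) → δ j e′ ∧ M′ i b′) ps
    ≡⟨ cong (M′ i j xor_) (∑ₗ-cong {P = AddsFrom B} adds (cong (δ j _ ∧_) ∘ unchanged ∘ proj₂)) ⟩
  (M i j xor (δ j e ∧ M i b)) xor ∑ₗ (λ (e′ , b′) → δ j e′ ∧ M i b′) ps
    ≡⟨ xor-assoc (M i j) _ _ ⟩
  M i j xor ∑ₗ (λ (e′ , b′) → δ j e′ ∧ M i b′) ((e , b) ∷ ps) ∎
  where
  open ≡-Reasoning
  M′ = addColumn e b M
  unchanged : ∀ {b′} → lookup B b′ ≡ true → M′ i b′ ≡ M i b′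
  unchanged Bb′ = col-≢ (addsFrom⇒≢ B e,b-adds) added (λ b′≡e → addsFrom⇒≢ B (proj₁ e,b-adds , Bb′) (sym b′≡e)) i
    where
    added : ColumnAdded e b M M′
    added = record { entries = λ _ _ → refl }

clearingSlides : ∀ {n} → Subset n → (Fin n → Subset n) → List (Fin n × Fin n)
clearingSlides B R = concatMap (λ e → map (e ,_) (elements (R e))) (elements (∁ B))

clearingSlides-addFrom : ∀ {n} (B : Subset n) R → (∀ e → R e ⊆ B) → All (AddsFrom B) (clearingSlides B R)
clearingSlides-addFrom B R R⊆B =
  Allₚ.concat⁺ (Allₚ.map⁺ (All.map from-target (elements-⊆ (∁ B))))
  where
  outside-B : ∀ {e} → lookup (∁ B) e ≡ true → lookup B e ≡ false
  outside-B {e} ∁Be with lookup B e | trans (sym (lookup-map e not B)) ∁Be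
  ... | false | _ = refl
  from-target : ∀ {e} → lookup (∁ B) e ≡ true → All (AddsFrom B) (map (e ,_) (elements (R e)))
  from-target {e} ∁Be = Allₚ.map⁺ (All.map (λ Reb → outside-B ∁Be , ⊆-lookup (R⊆B e) Reb) (elements-⊆ (R e)))

∑ₗ-clearingSlides : ∀ {r n} (B : Subset n) R (M : Matrix r n) i j →
  ∑ₗ (λ (e , b) → δ j e ∧ M i b) (clearingSlides B R) ≡ colSum M (R j) i ∧ lookup (∁ B) j
∑ₗ-clearingSlides B R M i j = begin
  ∑ₗ (λ (e , b) → δ j e ∧ M i b) (clearingSlides B R)
    ≡⟨ per-target (elements (∁ B)) ⟩
  ∑ₗ (λ e → δ j e ∧ colSum M (R e) i) (elements (∁ B))
    ≡⟨ ∑ₗ-elements _ (∁ B) ⟩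
  ∑ (λ e → (δ j e ∧ colSum M (R e) i) ∧ lookup (∁ B) e)
    ≡⟨ ∑-δ j _ (λ e e≢j → cong (λ d → (d ∧ _) ∧ lookup (∁ B) e) (δ-≢ (e≢j ∘ sym))) ⟩
  (δ j j ∧ colSum M (R j) i) ∧ lookup (∁ B) j
    ≡⟨ cong (λ d → (d ∧ colSum M (R j) i) ∧ lookup (∁ B) j) (δ-refl j) ⟩
  colSum M (R j) i ∧ lookup (∁ B) j ∎
  where
  open ≡-Reasoning
  per-target : ∀ es → ∑ₗ (λ (e , b) → δ j e ∧ M i b) (concatMap (λ e → map (e ,_) (elements (R e))) es)
                    ≡ ∑ₗ (λ e → δ j e ∧ colSum M (R e) i) es
  per-target []       = refl
  per-target (e ∷ es) = begin
    ∑ₗ _ (map (e ,_) (elements (R e)) ++ _)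
      ≡⟨ ∑ₗ-++ _ (map (e ,_) (elements (R e))) _ ⟩
    ∑ₗ _ (map (e ,_) (elements (R e))) xor _
      ≡⟨ cong₂ _xor_ (∑ₗ-map _ (e ,_) (elements (R e))) (per-target es) ⟩
    ∑ₗ (λ b → δ j e ∧ M i b) (elements (R e)) xor _
      ≡⟨ cong (_xor _) (∑ₗ-∧ (δ j e) (M i) (elements (R e))) ⟩
    (δ j e ∧ ∑ₗ (M i) (elements (R e))) xor _
      ≡⟨ cong (λ s → (δ j e ∧ s) xor ∑ₗ (λ e → δ j e ∧ colSum M (R e) i) es) (∑ₗ-elements (M i) (R e)) ⟩
    (δ j e ∧ colSum M (R e) i) xor ∑ₗ (λ e → δ j e ∧ colSum M (R e) i) es ∎

module _ {r n} {A A* : Matrix r n} {B : Subset n} (basis : IsBasis A B)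
         (inside-B : ∀ {j} → lookup B j ≡ true → col A* j ≗ col A j)
         (outside-B : ∀ {j} → lookup B j ≡ false → col A* j ≗ 0ᵥ) where

  independent-B : Independent A* B
  independent-B (T , T⊆B , nonempty , sum) =
    proj₁ basis (T , T⊆B , nonempty , λ i → trans (sym (colSum-cong T (inside-B ∘ []=⇒lookup ∘ T⊆B) i)) (sum i))

  isBasis-B : IsBasis A* B
  isBasis-B = Equivalence.from isBasis⇔independent×spanning (independent-B , spanning)
    where
    spanning : Spanning A* B
    spanning e with lookup B e in Be
    ... | true  = span-col Be
    ... | false = span-resp (λ i → sym (outside-B Be i)) span-0

  isBasis⇒⊆ : ∀ {S} → IsBasis A* S → S ⊆ B
  isBasis⇒⊆ {S} (independent , _) = ⊆-by-lookup at
    where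
    at : ∀ j → lookup S j ≡ true → lookup B j ≡ true
    at j Sj with lookup B j in Bj
    ... | true  = refl
    ... | false = contradiction (dependent-mono (insert-⊆ j (⊆-min S) Sj) singleton-dependent) independent
      where
      singleton-dependent : Dependent A* (∅ [ j ]≔ inside)
      singleton-dependent =
        span⇒dependent-insert (lookup-replicate j false) (span-resp (λ i → sym (outside-B Bj i)) span-0)

  isBasis⇒⊇ : ∀ {S} → IsBasis A* S → B ⊆ S
  isBasis⇒⊇ {S} basis* = ⊆-by-lookup at
    where
    at : ∀ j → lookup B j ≡ true → lookup S j ≡ true
    at j Bj with lookup S j in Sj
    ... | true  = refl
    ... | false = contradiction (dependent-mono (insert-⊆ j (isBasis⇒⊆ basis*) Bj) S∪j-dependent) independent-B
      where
      S∪j-dependent : Dependent A* (S [ j ]≔ inside)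
      S∪j-dependent = span⇒dependent-insert Sj (proj₂ (Equivalence.to isBasis⇔independent×spanning basis*) j)

  isBasis⇔≡ : ∀ S → IsBasis A* S ⇔ (S ≡ B)
  isBasis⇔≡ S = mk⇔ (λ basis* → ⊆-antisym (isBasis⇒⊆ basis*) (isBasis⇒⊇ basis*)) λ { refl → isBasis-B }

clear-outside-basis : ∀ {r n} (A : Matrix r n) {B} → IsBasis A B →
  Σ (List (Fin n × Fin n)) λ ps → All (AddsFrom B) ps × (∀ S → IsBasis (addColumns ps A) S ⇔ (S ≡ B))
clear-outside-basis A {B} basis = ps , adds , isBasis⇔≡ basis inside-B outside-B
  where
  spanning : Spanning A B
  spanning = proj₂ (Equivalence.to isBasis⇔independent×spanning basis)
  R : _ → Subset _
  R e = proj₁ (spanning e)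
  ps = clearingSlides B R
  adds : All (AddsFrom B) ps
  adds = clearingSlides-addFrom B R (proj₁ ∘ proj₂ ∘ spanning)
  entry : ∀ {j} x → lookup B j ≡ x → ∀ i → addColumns ps A i j ≡ A i j xor (colSum A (R j) i ∧ not x)
  entry {j} x Bj i = begin
    addColumns ps A i j
      ≡⟨ addColumns-sum B ps A adds i j ⟩
    A i j xor ∑ₗ (λ (e , b) → δ j e ∧ A i b) ps
      ≡⟨ cong (A i j xor_) (∑ₗ-clearingSlides B R A i j) ⟩
    A i j xor (colSum A (R j) i ∧ lookup (∁ B) j)
      ≡⟨ cong (λ y → A i j xor (colSum A (R j) i ∧ y)) (trans (lookup-map j not B) (cong not Bj)) ⟩
    A i j xor (colSum A (R j) i ∧ not x) ∎
    where open ≡-Reasoning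
  inside-B : ∀ {j} → lookup B j ≡ true → col (addColumns ps A) j ≗ col A j
  inside-B {j} Bj i = trans (entry true Bj i) (trans (cong (A i j xor_) (∧-zeroʳ _)) (xor-identityʳ (A i j)))
  outside-B : ∀ {j} → lookup B j ≡ false → col (addColumns ps A) j ≗ 0ᵥ
  outside-B {j} Bj i = trans (entry false Bj i) (trans (cong (A i j xor_) R-sum) (xor-same (A i j)))
    where
    R-sum : colSum A (R j) i ∧ true ≡ A i j
    R-sum = trans (∧-identityʳ _) (proj₂ (proj₂ (spanning j)) i)

theorem4 : (n : ℕ) (F : Family n) → Binary F →
    Σ (List (Fin n × Fin n)) λ ps →
      All (λ p → proj₁ p ≢ proj₂ p) ps ×
      Binary (slides ps F) ×
      (Σ (Subset n) λ B → ∀ S → slides ps F S ⇔ (S ≡ B))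
theorem4 n F (r , A , F⇔basis) with B , basis ← basis-exists A
  with ps , adds , unique ← clear-outside-basis A basis
  = ps , distinct , (r , addColumns ps A , slid⇔basis) , B , λ S → ⇔-trans (slid⇔basis S) (unique S)
  where
  distinct : All (λ p → proj₁ p ≢ proj₂ p) ps
  distinct = All.map (addsFrom⇒≢ B) adds
  slid⇔basis : ∀ S → slides ps F S ⇔ IsBasis (addColumns ps A) S
  slid⇔basis S = ⇔-trans (slides-cong ps F⇔basis S) (slides-isBasis ps A distinct S)
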